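{- Let $p_n$ denote the $n$-th prime and $\mathbb{P}$ the set of all primes. For a set $J$ of primes put $\mathbb{P}_J=\{p_n\mid n\in J\}$. Define $P^{(1)}=\mathbb{P}$ and $P^{(k)}=\mathbb{P}_{P^{(k-1)}}$ for $k\ge2$. Then for every integer $i\ge1$ there is a unique subset $J\subseteq P^{(i)}$ such that \[ P^{(i)}=J\cup\mathbb{P}_J\quad\text{and}\quad J\cap\mathbb{P}_J=\emptyset, \] i.e. $J=P^{(i)}-\mathbb{P}_J$.
   Context: $P^{(k)}$ is the set of $k$-th order primes: $P^{(1)}$ all primes, $P^{(2)}=\{p_{p_n}\}$ the prime-indexed primes, $P^{(3)}=\{p_{p_{p_n}}\}$, and so on. In the paper the set $J$ is named $\mathbb{P}^{(i)}$ and $\mathbb{P}_J$ is named $\mathbb{P}^{(i+1)}$, so the conclusion reads $\mathbb{P}^{(i)}=P^{(i)}-\mathbb{P}^{(i+1)}$. -}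

module Defs where

open import Level using (0ℓ)
open import Data.Nat using (ℕ; zero; suc)
open import Data.Nat.Primality using (Prime; prime?)
open import Data.List using (length; filter; upTo)
open import Data.Product using (∃; _×_)
open import Relation.Unary using (Pred; _∈_; ∅)
open import Relation.Binary.PropositionalEquality using (_≡_)

primeCount : ℕ → ℕ
primeCount m = length (filter prime? (upTo (suc m)))

-- NthPrime n p  :  p is the n-th prime p_n (1-indexed: p_1 = 2, p_2 = 3, ...)
NthPrime : ℕ → ℕ → Set
NthPrime n p = Prime p × primeCount p ≡ n

IndexedPrimes : Pred ℕ 0ℓ → Pred ℕ 0ℓ
IndexedPrimes J q = ∃ λ n → n ∈ J × NthPrime n q

-- P^(k): P^(1) = all primes, P^(k) = ℙ_{P^(k-1)} for k ≥ 2.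
-- (P^(0) is not used; it is set to the empty set by convention.)
PrimesOfOrder : ℕ → Pred ℕ 0ℓ
PrimesOfOrder zero = ∅
PrimesOfOrder (suc zero) = Prime
PrimesOfOrder (suc (suc k)) = IndexedPrimes (PrimesOfOrder (suc k))

{-# OPTIONS --safe #-}
module Submission where

-- For a prime q the index π(q) of q is smaller than q, so the two conditions
-- "q ∈ J iff q ∈ P⁽ⁱ⁾ and not (q is prime with π(q) ∈ J)" determine J by strong
-- induction on q; this gives both existence and uniqueness. Membership in J is
-- decidable along the way because P⁽ⁱ⁾ is, and P⁽ⁱ⁺¹⁾ ⊆ P⁽ⁱ⁾ makes J ∪ ℙ_J ⊆ P⁽ⁱ⁾.

open import Defs
open import Level using (0ℓ)
open import Data.Nat using (ℕ; zero; suc; 2+; _≥_; _<_; s≤s)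
open import Data.Nat.Properties using (module ≤-Reasoning; <-≤-trans; ≤-pred; n<1+n)
open import Data.Nat.Induction using (<-rec)
open import Data.Nat.Primality using (Prime; prime?)
open import Data.List using (List; length; filter; applyUpTo)
open import Data.List.Properties using (length-filter; length-applyUpTo)
open import Data.Product using (Σ; _×_; _,_; proj₁; proj₂)
open import Data.Sum using (inj₁; inj₂)
open import Data.Empty using (⊥; ⊥-elim)
open import Relation.Nullary using (¬_; yes; no)
open import Relation.Unary using (Pred; Decidable; _⊆_; _∪_; _∩_; _≐_; Empty)
open import Relation.Binary.PropositionalEquality using (refl; sym; subst)

primeCount< : ∀ {q} → Prime q → primeCount q < q
primeCount< {suc (suc r)} _ = s≤s (begin
  length (filter prime? fromTwo) ≤⟨ length-filter prime? fromTwo ⟩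
  length fromTwo                 ≡⟨ length-applyUpTo 2+ (suc r) ⟩
  suc r                          ∎)
  where
  open ≤-Reasoning
  -- 0 and 1 are rejected by prime? definitionally, leaving the list 2, …, q.
  fromTwo : List ℕ
  fromTwo = applyUpTo 2+ (suc r)

IndexedPrimes⁺ : ∀ {J : Pred ℕ 0ℓ} {q} → Prime q → J (primeCount q) → IndexedPrimes J q
IndexedPrimes⁺ p j = _ , j , p , refl

IndexedPrimes⁻ : ∀ {J : Pred ℕ 0ℓ} {q} → IndexedPrimes J q → Prime q × J (primeCount q)
IndexedPrimes⁻ {J} (n , j , p , πq≡n) = p , subst J (sym πq≡n) j

IndexedPrimes-mono : ∀ {A B : Pred ℕ 0ℓ} → A ⊆ B → IndexedPrimes A ⊆ IndexedPrimes B
IndexedPrimes-mono A⊆B (n , a , nth) = n , A⊆B a , nth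

IndexedPrimes? : ∀ {J : Pred ℕ 0ℓ} → Decidable J → Decidable (IndexedPrimes J)
IndexedPrimes? J? q with prime? q | J? (primeCount q)
... | yes p | yes j = yes (IndexedPrimes⁺ p j)
... | no ¬p | _     = no (λ x → ¬p (proj₁ (IndexedPrimes⁻ x)))
... | yes _ | no ¬j = no (λ x → ¬j (proj₂ (IndexedPrimes⁻ x)))

PrimesOfOrder? : ∀ k → Decidable (PrimesOfOrder k)
PrimesOfOrder? zero          _ = no (λ ())
PrimesOfOrder? (suc zero)      = prime?
PrimesOfOrder? (suc (suc k))   = IndexedPrimes? (PrimesOfOrder? (suc k))

IndexedPrimes-PrimesOfOrder⊆ : ∀ k → IndexedPrimes (PrimesOfOrder (suc k)) ⊆ PrimesOfOrder (suc k)
IndexedPrimes-PrimesOfOrder⊆ zero    (_ , _ , p , _) = p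
IndexedPrimes-PrimesOfOrder⊆ (suc k) = IndexedPrimes-mono (IndexedPrimes-PrimesOfOrder⊆ k)

IsSplitting : Pred ℕ 0ℓ → Pred ℕ 0ℓ → Set
IsSplitting S J = J ⊆ S × S ≐ (J ∪ IndexedPrimes J) × Empty (J ∩ IndexedPrimes J)

splitting⊆-step : ∀ {S J₁ J₂ : Pred ℕ 0ℓ} → IsSplitting S J₁ → IsSplitting S J₂ →
                  ∀ q → (∀ {m} → m < q → J₂ m → J₁ m) → J₁ q → J₂ q
splitting⊆-step (_ , (_ , J₁∪⊆S) , disjoint₁) (_ , (S⊆J₂∪ , _) , _) q below j₁
  with S⊆J₂∪ (J₁∪⊆S (inj₁ j₁))
... | inj₁ j₂                 = j₂
... | inj₂ (_ , j₂ , p , refl) = ⊥-elim (disjoint₁ q (j₁ , IndexedPrimes⁺ p (below (primeCount< p) j₂)))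

splitting-unique : ∀ {S J₁ J₂ : Pred ℕ 0ℓ} → IsSplitting S J₁ → IsSplitting S J₂ → J₁ ≐ J₂
splitting-unique {J₁ = J₁} {J₂} s₁ s₂ = (λ {q} → proj₁ (both q)) , (λ {q} → proj₂ (both q))
  where
  both : ∀ q → (J₁ q → J₂ q) × (J₂ q → J₁ q)
  both = <-rec _ λ q ih →
    splitting⊆-step s₁ s₂ q (λ m<q → proj₂ (ih m<q)) ,
    splitting⊆-step s₂ s₁ q (λ m<q → proj₁ (ih m<q))

module Splitting (S : Pred ℕ 0ℓ) (S? : Decidable S) (closed : IndexedPrimes S ⊆ S) where

  -- The defining condition of J unfolded k times; it stabilises once k > q.
  Within : ℕ → Pred ℕ 0ℓ
  Within zero    _ = ⊥
  Within (suc k) q = S q × ¬ (Prime q × Within k (primeCount q))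

  Within? : ∀ k → Decidable (Within k)
  Within? zero    _ = no (λ ())
  Within? (suc k) q with S? q | prime? q | Within? k (primeCount q)
  ... | no ¬s | _     | _     = no (λ w → ¬s (proj₁ w))
  ... | yes s | no ¬p | _     = yes (s , λ x → ¬p (proj₁ x))
  ... | yes s | yes _ | no ¬w = yes (s , λ x → ¬w (proj₂ x))
  ... | yes _ | yes p | yes w = no (λ x → proj₂ x (p , w))

  Within-fuel : ∀ {k k′ q} → q < k → q < k′ → Within k q → Within k′ q
  Within-fuel {suc k} {suc k′} q<k q<k′ (s , h) = s , λ { (p , w) →
    h (p , Within-fuel (<-≤-trans (primeCount< p) (≤-pred q<k′)) (<-≤-trans (primeCount< p) (≤-pred q<k)) w) }

  J : Pred ℕ 0ℓ
  J q = Within (suc q) q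

  J? : Decidable J
  J? q = Within? (suc q) q

  J⊆S : J ⊆ S
  J⊆S = proj₁

  J-not-indexed : ∀ {q} → J q → ¬ (Prime q × J (primeCount q))
  J-not-indexed (_ , h) (p , j) = h (p , Within-fuel (n<1+n _) (primeCount< p) j)

  J⁺ : ∀ {q} → S q → ¬ (Prime q × J (primeCount q)) → J q
  J⁺ s h = s , λ { (p , w) → h (p , Within-fuel (primeCount< p) (n<1+n _) w) }

  S⊆J∪IndexedPrimes : S ⊆ (J ∪ IndexedPrimes J)
  S⊆J∪IndexedPrimes {q} s with prime? q | J? (primeCount q)
  ... | yes p | yes j = inj₂ (IndexedPrimes⁺ p j)
  ... | no ¬p | _     = inj₁ (J⁺ s (λ x → ¬p (proj₁ x)))
  ... | yes _ | no ¬j = inj₁ (J⁺ s (λ x → ¬j (proj₂ x)))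

  J∪IndexedPrimes⊆S : (J ∪ IndexedPrimes J) ⊆ S
  J∪IndexedPrimes⊆S (inj₁ j) = J⊆S j
  J∪IndexedPrimes⊆S (inj₂ x) = closed (IndexedPrimes-mono J⊆S x)

  J-isSplitting : IsSplitting S J
  J-isSplitting = J⊆S , (S⊆J∪IndexedPrimes , J∪IndexedPrimes⊆S) ,
                  λ q (j , x) → J-not-indexed j (IndexedPrimes⁻ x)

theorem6p1 : (i : ℕ) → i ≥ 1 →
    Σ (Pred ℕ 0ℓ) (λ J →
      (J ⊆ PrimesOfOrder i × PrimesOfOrder i ≐ (J ∪ IndexedPrimes J) × Empty (J ∩ IndexedPrimes J))
      × ((J′ : Pred ℕ 0ℓ) →
          J′ ⊆ PrimesOfOrder i × PrimesOfOrder i ≐ (J′ ∪ IndexedPrimes J′) × Empty (J′ ∩ IndexedPrimes J′) →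
          J′ ≐ J))
theorem6p1 (suc k) _ = J , J-isSplitting , λ _ s → splitting-unique s J-isSplitting
  where
  open Splitting (PrimesOfOrder (suc k)) (PrimesOfOrder? (suc k)) (IndexedPrimes-PrimesOfOrder⊆ k)
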